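{- Let $X$ and $Y$ be finite disjoint sets and $Q$ a partial order relation on $Y$. The mapping $$\Phi : \mathfrak{F}_Q(X,Y) \to \mathfrak{M}_Q(X,Y),\qquad (P,f) \mapsto P \cup Q \cup \bigcup_{y \in Y} \big(f(y) \times \{y\}\big)$$ is a well-defined bijection, with inverse $R \mapsto (R|_X, \psi_R)$ where $\psi_R : Y \to \mathcal{L}(R|_X)$, $\psi_R(y) = (\downarrow_R y) \setminus Y$.
   Context: A partial order relation (p.o.r.) on a set $S$ is a reflexive, antisymmetric, transitive subset of $S \times S$; $\mathfrak{P}(S)$ is the set of p.o.r.s on $S$. For $R \in \mathfrak{P}(S)$ and $M \subseteq S$: $R|_M = R \cap (M\times M)$; $\downarrow_R y = \{x : (x,y) \in R\}$. A lower end of $R$ is a set $L$ with $(x,l) \in R$, $l \in L \Rightarrow x \in L$; $\mathcal{L}(R)$ is the set of lower ends. Upper end: $U$ with $u \in U$, $(u,x)\in R \Rightarrow x\in U$. Convex: $(a,x),(x,b) \in R$, $a,b \in M$ imply $x \in M$. Define $\mathfrak{U}(X,Y) = \{R \in \mathfrak{P}(X\cup Y) : Y \text{ is an upper end of } R\}$, $\mathfrak{C}_Q(X,Y) = \{R \in \mathfrak{P}(X \cup Y) : R|_Y = Q \text{ and } Y \text{ convex in } R\}$, $\mathfrak{M}_Q(X,Y) = \mathfrak{U}(X,Y) \cap \mathfrak{C}_Q(X,Y)$. For $P \in \mathfrak{P}(X)$, $\mathcal{H}_Q(Y,\mathcal{L}(P))$ is the set of maps $f : Y \to \mathcal{L}(P)$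 with $(a,b) \in Q \Rightarrow f(a) \subseteq f(b)$. $\mathfrak{F}_Q(X,Y)$ is the set of all pairs $(P,f)$ with $P \in \mathfrak{P}(X)$ and $f \in \mathcal{H}_Q(Y,\mathcal{L}(P))$. -}

module Defs where

open import Data.Bool using (Bool; true; false; T; _∨_; _∧_; not)
open import Data.Nat using (ℕ)
open import Data.Fin using (Fin)
open import Data.Sum using (_⊎_; inj₁; inj₂)
open import Data.Product using (_×_)
open import Relation.Binary.PropositionalEquality using (_≡_)

-- Subsets of a (finite) set A are decidable predicates A → Bool;
-- binary relations on A (subsets of A × A) are A → A → Bool.
Subset : Set → Set
Subset A = A → Bool

BRel : Set → Set
BRel A = A → A → Bool

record IsPOR {A : Set} (R : BRel A) : Set where
  field
    refl    : ∀ a → T (R a a)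
    antisym : ∀ a b → T (R a b) → T (R b a) → a ≡ b
    trans   : ∀ a b c → T (R a b) → T (R b c) → T (R a c)

LowerEnd : {A : Set} → BRel A → Subset A → Set
LowerEnd R L = ∀ x l → T (R x l) → T (L l) → T (L x)

UpperEnd : {A : Set} → BRel A → Subset A → Set
UpperEnd R U = ∀ u x → T (U u) → T (R u x) → T (U x)

Convex : {A : Set} → BRel A → Subset A → Set
Convex R M = ∀ a x b → T (M a) → T (M b) → T (R a x) → T (R x b) → T (M x)

down : {A : Set} → BRel A → A → Subset A
down R y x = R x y

_≐_ : {A : Set} → BRel A → BRel A → Set
R ≐ S = ∀ a b → R a b ≡ S a b

-- The finite disjoint sets X = Fin m and Y = Fin n; X ∪ Y is Fin m ⊎ Fin n.
Un : ℕ → ℕ → Set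
Un m n = Fin m ⊎ Fin n

Xs : {m n : ℕ} → Subset (Un m n)
Xs (inj₁ _) = true
Xs (inj₂ _) = false

Ys : {m n : ℕ} → Subset (Un m n)
Ys (inj₁ _) = false
Ys (inj₂ _) = true

restrX : {m n : ℕ} → BRel (Un m n) → BRel (Fin m)
restrX R x x' = R (inj₁ x) (inj₁ x')

restrY : {m n : ℕ} → BRel (Un m n) → BRel (Fin n)
restrY R y y' = R (inj₂ y) (inj₂ y')

record IsF {m n : ℕ} (Q : BRel (Fin n)) (P : BRel (Fin m)) (f : Fin n → Subset (Fin m)) : Set where
  field
    P-por     : IsPOR P
    f-lower   : ∀ y → LowerEnd P (f y)
    f-mono    : ∀ a b → T (Q a b) → ∀ x → T (f a x) → T (f b x)

record IsM {m n : ℕ} (Q : BRel (Fin n)) (R : BRel (Un m n)) : Set where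
  field
    R-por    : IsPOR R
    Y-upper  : UpperEnd R Ys
    R|Y≐Q    : restrY R ≐ Q
    Y-convex : Convex R Ys

liftX : {m n : ℕ} → BRel (Fin m) → BRel (Un m n)
liftX P (inj₁ x) (inj₁ x') = P x x'
liftX P _ _ = false

liftY : {m n : ℕ} → BRel (Fin n) → BRel (Un m n)
liftY Q (inj₂ y) (inj₂ y') = Q y y'
liftY Q _ _ = false

graphU : {m n : ℕ} → (Fin n → Subset (Fin m)) → BRel (Un m n)
graphU f (inj₁ x) (inj₂ y) = f y x
graphU f _ _ = false

Φ : {m n : ℕ} → BRel (Fin n) → BRel (Fin m) → (Fin n → Subset (Fin m)) → BRel (Un m n)
Φ Q P f a b = liftX P a b ∨ liftY Q a b ∨ graphU f a b

ψ : {m n : ℕ} → BRel (Un m n) → Fin n → Subset (Fin m)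
ψ {m} {n} R y x = down R (inj₂ y) (inj₁ x) ∧ not (Ys {m} {n} (inj₁ x))

-- Φ only glues P, Q and the graph of f, and never relates an element of Y to
-- one of X; so P- and Q-comparabilities are preserved, transitivity across the
-- seam is exactly "f y is a lower end" and "f is monotone", and Y is an upper
-- end (hence convex).  Conversely an R in 𝔐_Q is determined by its four blocks:
-- the X×X block is R|_X, the X×Y block is ψ_R, the Y×Y block is Q, and the
-- Y×X block is empty because Y is an upper end.
module Submission where

open import Defs
open import Data.Nat using (ℕ)
open import Data.Fin using (Fin)
open import Data.Product using (_×_; _,_)
open import Data.Sum using (inj₁; inj₂)
open import Data.Sum.Properties using (inj₁-injective)
open import Data.Bool using (true; false; T)
open import Data.Bool.Properties using (∨-identityʳ; ∧-identityʳ)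
open import Data.Empty using (⊥-elim)
open import Function.Definitions using (Injective)
open import Relation.Binary.PropositionalEquality using (_≡_; refl; sym; trans; subst)

IsPOR-pullback : {A B : Set} {g : A → B} {R : BRel B} →
                 Injective _≡_ _≡_ g → IsPOR R → IsPOR (λ a a′ → R (g a) (g a′))
IsPOR-pullback g-inj R-por = record
  { refl    = λ a → R.refl _
  ; antisym = λ a b p q → g-inj (R.antisym _ _ p q)
  ; trans   = λ a b c → R.trans _ _ _
  }
  where module R = IsPOR R-por

UpperEnd⇒Convex : {A : Set} {R : BRel A} {M : Subset A} → UpperEnd R M → Convex R M
UpperEnd⇒Convex M-upper a x b a∈M b∈M aRx xRb = M-upper a x a∈M aRx

module _ {m n : ℕ} (Q : BRel (Fin n)) (P : BRel (Fin m)) (f : Fin n → Subset (Fin m)) where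

  Φ-X : ∀ x x′ → Φ Q P f (inj₁ x) (inj₁ x′) ≡ P x x′
  Φ-X x x′ = ∨-identityʳ (P x x′)

  Φ-Y : ∀ y y′ → Φ Q P f (inj₂ y) (inj₂ y′) ≡ Q y y′
  Φ-Y y y′ = ∨-identityʳ (Q y y′)

ψ-graph : {m n : ℕ} (R : BRel (Un m n)) → ∀ y x → ψ R y x ≡ R (inj₁ x) (inj₂ y)
ψ-graph R y x = ∧-identityʳ (R (inj₁ x) (inj₂ y))

module _ {m n : ℕ} {Q : BRel (Fin n)} {P : BRel (Fin m)} {f : Fin n → Subset (Fin m)}
         (Q-por : IsPOR Q) (F : IsF Q P f) where

  open IsF F
  private
    module P = IsPOR P-por
    module Q = IsPOR Q-por
    R = Φ Q P f

    toX : ∀ {x x′} → T (P x x′) → T (R (inj₁ x) (inj₁ x′))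
    toX = subst T (sym (Φ-X Q P f _ _))

    fromX : ∀ {x x′} → T (R (inj₁ x) (inj₁ x′)) → T (P x x′)
    fromX = subst T (Φ-X Q P f _ _)

    toY : ∀ {y y′} → T (Q y y′) → T (R (inj₂ y) (inj₂ y′))
    toY = subst T (sym (Φ-Y Q P f _ _))

    fromY : ∀ {y y′} → T (R (inj₂ y) (inj₂ y′)) → T (Q y y′)
    fromY = subst T (Φ-Y Q P f _ _)

  Φ-refl : ∀ a → T (R a a)
  Φ-refl (inj₁ x) = toX (P.refl x)
  Φ-refl (inj₂ y) = toY (Q.refl y)

  Φ-antisym : ∀ a b → T (R a b) → T (R b a) → a ≡ b
  Φ-antisym (inj₁ x) (inj₁ x′) p q with P.antisym x x′ (fromX p) (fromX q)
  ... | refl = refl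
  Φ-antisym (inj₂ y) (inj₂ y′) p q with Q.antisym y y′ (fromY p) (fromY q)
  ... | refl = refl
  Φ-antisym (inj₂ y) (inj₁ x)  ()

  Φ-trans : ∀ a b c → T (R a b) → T (R b c) → T (R a c)
  Φ-trans (inj₁ x) (inj₁ x′) (inj₁ x″) p q = toX (P.trans x x′ x″ (fromX p) (fromX q))
  Φ-trans (inj₁ x) (inj₁ x′) (inj₂ y)  p q = f-lower y x x′ (fromX p) q
  Φ-trans (inj₁ x) (inj₂ y)  (inj₂ y′) p q = f-mono y y′ (fromY q) x p
  Φ-trans (inj₂ y) (inj₂ y′) (inj₂ y″) p q = toY (Q.trans y y′ y″ (fromY p) (fromY q))
  Φ-trans (inj₁ x) (inj₂ y)  (inj₁ x′) p ()
  Φ-trans (inj₂ y) (inj₂ y′) (inj₁ x)  p ()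
  Φ-trans (inj₂ y) (inj₁ x)  c         ()

  Φ-Y-upper : UpperEnd R Ys
  Φ-Y-upper (inj₂ y) (inj₂ y′) y∈Y yRy′ = y∈Y

  Φ-isM : IsM Q R
  Φ-isM = record
    { R-por    = record { refl = Φ-refl ; antisym = Φ-antisym ; trans = Φ-trans }
    ; Y-upper  = Φ-Y-upper
    ; R|Y≐Q    = Φ-Y Q P f
    ; Y-convex = UpperEnd⇒Convex Φ-Y-upper
    }

module _ {m n : ℕ} {Q : BRel (Fin n)} {R : BRel (Un m n)} (M : IsM Q R) where

  open IsM M
  private module R = IsPOR R-por

  private
    toψ : ∀ {y x} → T (R (inj₁ x) (inj₂ y)) → T (ψ R y x)
    toψ = subst T (sym (ψ-graph R _ _))

    fromψ : ∀ {y x} → T (ψ R y x) → T (R (inj₁ x) (inj₂ y))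
    fromψ = subst T (ψ-graph R _ _)

  ψ-isF : IsF Q (restrX R) (ψ R)
  ψ-isF = record
    { P-por   = IsPOR-pullback inj₁-injective R-por
    ; f-lower = λ y x l xRl l∈ψy → toψ (R.trans _ _ _ xRl (fromψ l∈ψy))
    ; f-mono  = λ a b aQb x x∈ψa →
                  toψ (R.trans _ _ _ (fromψ x∈ψa) (subst T (sym (R|Y≐Q a b)) aQb))
    }

  Y↛X : ∀ y x → R (inj₂ y) (inj₁ x) ≡ false
  Y↛X y x with R (inj₂ y) (inj₁ x) in yRx
  ... | false = refl
  ... | true  = ⊥-elim (Y-upper (inj₂ y) (inj₁ x) _ (subst T (sym yRx) _))

  Φ-restrX-ψ : Φ Q (restrX R) (ψ R) ≐ R
  Φ-restrX-ψ (inj₁ x) (inj₁ x′) = Φ-X Q (restrX R) (ψ R) x x′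
  Φ-restrX-ψ (inj₁ x) (inj₂ y)  = ψ-graph R y x
  Φ-restrX-ψ (inj₂ y) (inj₁ x)  = sym (Y↛X y x)
  Φ-restrX-ψ (inj₂ y) (inj₂ y′) = trans (Φ-Y Q (restrX R) (ψ R) y y′) (sym (R|Y≐Q y y′))

lemma2 : (m n : ℕ) (Q : BRel (Fin n)) → IsPOR Q →
    ((P : BRel (Fin m)) (f : Fin n → Subset (Fin m)) → IsF Q P f → IsM Q (Φ Q P f))
    × ((R : BRel (Un m n)) → IsM Q R → IsF Q (restrX R) (ψ R))
    × ((P : BRel (Fin m)) (f : Fin n → Subset (Fin m)) → IsF Q P f →
    (restrX (Φ Q P f) ≐ P) × (∀ y x → ψ (Φ Q P f) y x ≡ f y x))
    × ((R : BRel (Un m n)) → IsM Q R → Φ Q (restrX R) (ψ R) ≐ R)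
lemma2 m n Q Q-por =
    (λ P f F → Φ-isM Q-por F)
  , (λ R M → ψ-isF M)
  , (λ P f F → Φ-X Q P f , λ y x → ψ-graph (Φ Q P f) y x)
  , (λ R M → Φ-restrX-ψ M)
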